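{- Let $G=(V,E)$ be a connected unweighted graph, $k>\alpha\ge0$ integers, and $L:V\to\mathbb{Z}_{\ge0}$. Replace every $L_u>|V|$ by $|V|$. Let $B$ be the set produced by the following procedure: start with $B=\emptyset$; while there is a set $U\subseteq V$ with $|U|\le\alpha$ and $L(U)>L(B\cap N^6(U))$, set $B\leftarrow (B\setminus N^6(U))\cup U$. If the instance $(G,k,L,\alpha)$ is feasible for the capacitated conservative $\alpha$-fault-tolerant $k$-center, then the instance $(G,k-|B|,L')$ is feasible for the capacitated $k$-center, where $L'_u=0$ for $u\in B$ and $L'_u=L_u$ otherwise.
   Context: $d$ is the shortest-path metric of $G$; $N^\ell(U)=\{v: d(v,u)\le\ell \text{ for some } u\in U\}$; $L(X)=\sum_{x\in X}L_x$. An instance $(G,k',L')$ of the capacitated $k$-center is feasible if there exist $S\subseteq V$ with $|S|=k'$ and $\phi:V\to S$ with $d(u,\phi(u))\le1$ for all $u$ and $|\phi^{ -1}(v)|\le L'_v$. The instance $(G,k,L,\alpha)$ of the capacitated conservative $\alpha$-fault-tolerant $k$-center is feasible if there exist $S\subseteq V$ with $|S|=k$ and $\phi_0:V\to S$ capacity-respecting with $d(u,\phi_0(u))\le1$, such that for every $F\subseteq S$ with $|F|\le\alpha$ there is a capacity-respecting $\phi_F:V\to S\setminus F$ with $d(u,\phi_F(u))\le1$ for all $u$ and $\phi_F(u)=\phi_0(u)$ whenever $\phi_0(u)\notin F$. -}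

module Defs where

open import Data.Nat using (ℕ; zero; suc; _+_; _≤_; _<_; _⊓_)
open import Data.Bool using (Bool; true; false; _∧_; _∨_; if_then_else_)
open import Data.Fin using (Fin; _≟_)
open import Data.Fin.Subset using (Subset; _∈_; _∉_; _⊆_; _∩_; _∪_; _─_; ∣_∣; ⁅_⁆; ⊥)
open import Data.Vec using (lookup; tabulate)
open import Data.List using (List; map; allFin)
open import Data.Nat.ListAction using (sum)
open import Data.Bool.ListAction using (any)
open import Data.Product using (Σ; ∃; _×_; _,_)
open import Relation.Nullary.Decidable using (⌊_⌋)
open import Relation.Binary.PropositionalEquality using (_≡_)
open import Relation.Binary.Construct.Closure.ReflexiveTransitive using (Star)

record Graph (n : ℕ) : Set where
  field
    adj   : Fin n → Fin n → Bool
    sym   : ∀ u v → adj u v ≡ adj v u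
    irrefl : ∀ u → adj u u ≡ false
open Graph public

Σᵥ : {n : ℕ} → (Fin n → ℕ) → ℕ
Σᵥ {n} f = sum (map f (allFin n))

-- N^ℓ(U) = { v : d(v,u) ≤ ℓ for some u ∈ U }, where d is the shortest-path
-- metric: N^0(U) = U and N^(ℓ+1)(U) = N^ℓ(U) together with all neighbours
-- of vertices of N^ℓ(U).
N^ : {n : ℕ} → Graph n → ℕ → Subset n → Subset n
N^ G zero    U = U
N^ {n} G (suc ℓ) U =
  tabulate λ v → lookup (N^ G ℓ U) v ∨ any (λ w → lookup (N^ G ℓ U) w ∧ adj G w v) (allFin n)

Dist≤ : {n : ℕ} → Graph n → ℕ → Fin n → Fin n → Set
Dist≤ G ℓ u v = v ∈ N^ G ℓ ⁅ u ⁆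

Connected : {n : ℕ} → Graph n → Set
Connected G = ∀ u v → ∃ λ ℓ → Dist≤ G ℓ u v

wt : {n : ℕ} → (Fin n → ℕ) → Subset n → ℕ
wt L X = Σᵥ λ x → if lookup X x then L x else 0

preimageSize : {n : ℕ} → (Fin n → Fin n) → Fin n → ℕ
preimageSize φ v = Σᵥ λ u → if ⌊ φ u ≟ v ⌋ then 1 else 0

ValidAssignment : {n : ℕ} → Graph n → (Fin n → ℕ) → Subset n → (Fin n → Fin n) → Set
ValidAssignment G L S φ =
  (∀ u → φ u ∈ S) × (∀ u → Dist≤ G 1 u (φ u)) × (∀ v → preimageSize φ v ≤ L v)

CkCFeasible : {n : ℕ} → Graph n → ℕ → (Fin n → ℕ) → Set
CkCFeasible {n} G k' L' =
  Σ (Subset n) λ S → ∣ S ∣ ≡ k' × Σ (Fin n → Fin n) λ φ → ValidAssignment G L' S φ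

FTFeasible : {n : ℕ} → Graph n → ℕ → (Fin n → ℕ) → ℕ → Set
FTFeasible {n} G k L α =
  Σ (Subset n) λ S → ∣ S ∣ ≡ k × Σ (Fin n → Fin n) λ φ₀ → ValidAssignment G L S φ₀ ×
    (∀ (F : Subset n) → F ⊆ S → ∣ F ∣ ≤ α →
      Σ (Fin n → Fin n) λ φF →
        ValidAssignment G L S φF × (∀ u → φF u ∉ F) × (∀ u → φ₀ u ∉ F → φF u ≡ φ₀ u))

cap : {n : ℕ} → (Fin n → ℕ) → Fin n → ℕ
cap {n} L u = L u ⊓ n

Step : {n : ℕ} → Graph n → (Fin n → ℕ) → ℕ → Subset n → Subset n → Set
Step {n} G L α B B′ =
  Σ (Subset n) λ U → ∣ U ∣ ≤ α × wt L (B ∩ N^ G 6 U) < wt L U × B′ ≡ (B ─ N^ G 6 U) ∪ U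

Stopped : {n : ℕ} → Graph n → (Fin n → ℕ) → ℕ → Subset n → Set
Stopped {n} G L α B =
  ∀ (U : Subset n) → ∣ U ∣ ≤ α → wt L U ≤ wt L (B ∩ N^ G 6 U)

ProcedureOutput : {n : ℕ} → Graph n → (Fin n → ℕ) → ℕ → Subset n → Set
ProcedureOutput G L α B = Star (Step G L α) ⊥ B × Stopped G L α B

zeroOn : {n : ℕ} → Subset n → (Fin n → ℕ) → Fin n → ℕ
zeroOn B L u = if lookup B u then 0 else L u

-- Each step of the procedure adds a set U of at most α vertices after deleting
-- everything within distance 6 of U, so B, like every subset of it, is a union of
-- clusters of size at most α, each at distance more than 6 from the earlier ones.
-- Clusters are added one at a time while maintaining a set F of |B| closed centres
-- with S ∩ B ⊆ F ⊆ S ∩ N¹(B), and an assignment to S ∖ F that differs from φ₀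
-- only on clients it sends within distance 3 of B. Closing all centres within
-- distance 1 of a single client would strand it, so fault tolerance gives
-- |S ∩ N¹(C)| > α ≥ |C| and a new cluster C can be covered by |C| centres
-- F_C ⊆ S ∩ N¹(C). The recovery assignment for F_C moves only clients whose
-- centre lies in F_C, to centres within distance 3 of C, and the separation
-- 6 = 3 + 3 keeps this change apart from the earlier ones. In the end S ∖ F has
-- k − |B| centres, none of which lies in B.
module Submission where

open import Defs
open import Data.Nat using (ℕ; zero; suc; _+_; _≤_; _<_; _∸_; z≤n; s≤s)
open import Data.Nat.Properties
  using (≤-refl; ≤-reflexive; ≤-trans; ≤-<-trans; <-≤-trans; <⇒≤; ≤-antisym; ≰⇒>; _≤?_;
         m≤n+m; n≤1+n; +-suc; +-mono-≤; m+n∸n≡m)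
open import Data.Nat.ListAction using (sum)
open import Data.Bool using (T; true; false; _∧_; if_then_else_)
open import Data.Bool.Properties using (T-≡; T-∨; T-∧)
open import Data.Bool.ListAction using (any)
open import Data.Fin using (Fin; _≟_)
open import Data.Fin.Subset using (Subset; _∈_; _∉_; _⊆_; _∩_; _∪_; _─_; ∣_∣; ⁅_⁆; ⊥; inside; outside)
open import Data.Fin.Subset.Properties
open import Data.Vec using ([]; _∷_; here; there; lookup)
open import Data.Vec.Properties using (lookup∘tabulate; []=⇒lookup; lookup⇒[]=)
open import Data.List using ([]; _∷_; map; allFin)
open import Data.List.Relation.Unary.Any using (satisfied)
open import Data.List.Relation.Unary.Any.Properties using (any⁺; any⁻)
open import Data.List.Membership.Propositional using (lose)
open import Data.List.Membership.Propositional.Properties using (∈-allFin)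
open import Data.Product using (Σ; ∃; _×_; _,_; proj₁; proj₂)
open import Data.Sum using (_⊎_; inj₁; inj₂; [_,_]; map₂) renaming (map to ⊎-map)
open import Data.Empty using (⊥-elim)
open import Function.Bundles using (_⇔_; mk⇔; Equivalence)
open import Relation.Binary.PropositionalEquality
  using (_≡_; _≢_; refl; trans; subst; cong; cong₂; module ≡-Reasoning) renaming (sym to ≡-sym)
open import Relation.Binary.Construct.Closure.ReflexiveTransitive using (Star; ε; _◅_)
open import Relation.Nullary using (yes; no)
open import Relation.Nullary.Decidable using (⌊_⌋)

x∈p─q⇒x∉q : ∀ {n} {p q : Subset n} {x} → x ∈ p ─ q → x ∉ q
x∈p─q⇒x∉q {p = inside ∷ p} {outside ∷ q} here ()
x∈p─q⇒x∉q {p = _ ∷ p}      {_ ∷ q}       (there x∈p─q) (there x∈q) = x∈p─q⇒x∉q {p = p} x∈p─q x∈q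

∪-lub : ∀ {n} {p q r : Subset n} → p ⊆ r → q ⊆ r → p ∪ q ⊆ r
∪-lub {p = p} {q} p⊆r q⊆r x∈p∪q = [ p⊆r , q⊆r ] (x∈p∪q⁻ p q x∈p∪q)

∪-mono : ∀ {n} {p p′ q q′ : Subset n} → p ⊆ p′ → q ⊆ q′ → p ∪ q ⊆ p′ ∪ q′
∪-mono {q′ = q′} p⊆p′ q⊆q′ = ∪-lub (⊆-trans p⊆p′ (p⊆p∪q q′)) (⊆-trans q⊆q′ (q⊆p∪q _ q′))

∩-monoʳ : ∀ {n} (p : Subset n) {q r} → q ⊆ r → p ∩ q ⊆ p ∩ r
∩-monoʳ p {q} q⊆r x∈p∩q with x∈p∩q⁻ p q x∈p∩q
... | x∈p , x∈q = x∈p∩q⁺ (x∈p , q⊆r x∈q)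

∣p∪q∣≡∣p∣+∣q∣ : ∀ {n} (p q : Subset n) → (∀ {x} → x ∈ p → x ∉ q) → ∣ p ∪ q ∣ ≡ ∣ p ∣ + ∣ q ∣
∣p∪q∣≡∣p∣+∣q∣ []            []            _    = refl
∣p∪q∣≡∣p∣+∣q∣ (inside  ∷ p) (inside  ∷ q) disj = ⊥-elim (disj here here)
∣p∪q∣≡∣p∣+∣q∣ (inside  ∷ p) (outside ∷ q) disj =
  cong suc (∣p∪q∣≡∣p∣+∣q∣ p q λ x∈p x∈q → disj (there x∈p) (there x∈q))
∣p∪q∣≡∣p∣+∣q∣ (outside ∷ p) (inside  ∷ q) disj =
  trans (cong suc (∣p∪q∣≡∣p∣+∣q∣ p q λ x∈p x∈q → disj (there x∈p) (there x∈q))) (≡-sym (+-suc ∣ p ∣ ∣ q ∣))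
∣p∪q∣≡∣p∣+∣q∣ (outside ∷ p) (outside ∷ q) disj =
  ∣p∪q∣≡∣p∣+∣q∣ p q λ x∈p x∈q → disj (there x∈p) (there x∈q)

∣p─q∣+∣q∣≡∣p∣ : ∀ {n} (p q : Subset n) → q ⊆ p → ∣ p ─ q ∣ + ∣ q ∣ ≡ ∣ p ∣
∣p─q∣+∣q∣≡∣p∣ []            []            _   = refl
∣p─q∣+∣q∣≡∣p∣ (inside  ∷ p) (inside  ∷ q) q⊆p =
  trans (+-suc ∣ p ─ q ∣ ∣ q ∣) (cong suc (∣p─q∣+∣q∣≡∣p∣ p q (drop-∷-⊆ q⊆p)))
∣p─q∣+∣q∣≡∣p∣ (inside  ∷ p) (outside ∷ q) q⊆p = cong suc (∣p─q∣+∣q∣≡∣p∣ p q (drop-∷-⊆ q⊆p))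
∣p─q∣+∣q∣≡∣p∣ (outside ∷ p) (inside  ∷ q) q⊆p with q⊆p here
... | ()
∣p─q∣+∣q∣≡∣p∣ (outside ∷ p) (outside ∷ q) q⊆p = ∣p─q∣+∣q∣≡∣p∣ p q (drop-∷-⊆ q⊆p)

⊆-interpolate : ∀ {n} (p q : Subset n) m → p ⊆ q → ∣ p ∣ ≤ m → m ≤ ∣ q ∣ →
                ∃ λ r → p ⊆ r × r ⊆ q × ∣ r ∣ ≡ m
⊆-interpolate []            []            zero    _   _   _   = [] , (λ ()) , (λ ()) , refl
⊆-interpolate (inside  ∷ p) (inside  ∷ q) (suc m) p⊆q (s≤s p≤m) (s≤s m≤q)
  with ⊆-interpolate p q m (drop-∷-⊆ p⊆q) p≤m m≤q
... | r , p⊆r , r⊆q , ∣r∣≡m = inside ∷ r , s⊆s p⊆r , s⊆s r⊆q , cong suc ∣r∣≡m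
⊆-interpolate (inside  ∷ p) (outside ∷ q) m       p⊆q _ _ with p⊆q here
... | ()
⊆-interpolate (outside ∷ p) (outside ∷ q) m       p⊆q p≤m m≤q
  with ⊆-interpolate p q m (drop-∷-⊆ p⊆q) p≤m m≤q
... | r , p⊆r , r⊆q , ∣r∣≡m = outside ∷ r , s⊆s p⊆r , s⊆s r⊆q , ∣r∣≡m
⊆-interpolate (outside ∷ p) (inside  ∷ q) m       p⊆q p≤m m≤1+q with m ≤? ∣ q ∣
... | yes m≤q with ⊆-interpolate p q m (drop-∷-⊆ p⊆q) p≤m m≤q
...   | r , p⊆r , r⊆q , ∣r∣≡m = outside ∷ r , s⊆s p⊆r , out⊆ r⊆q , ∣r∣≡m
⊆-interpolate (outside ∷ p) (inside  ∷ q) m       p⊆q p≤m m≤1+q | no m≰q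
  with ≤-antisym m≤1+q (≰⇒> m≰q)
... | refl with ⊆-interpolate p q ∣ q ∣ (drop-∷-⊆ p⊆q) (p⊆q⇒∣p∣≤∣q∣ (drop-∷-⊆ p⊆q)) ≤-refl
...   | r , p⊆r , r⊆q , ∣r∣≡q = inside ∷ r , out⊆ p⊆r , s⊆s r⊆q , cong suc ∣r∣≡q

sum-map-mono : ∀ {A : Set} {f g : A → ℕ} → (∀ x → f x ≤ g x) → ∀ xs → sum (map f xs) ≤ sum (map g xs)
sum-map-mono f≤g []       = z≤n
sum-map-mono f≤g (x ∷ xs) = +-mono-≤ (f≤g x) (sum-map-mono f≤g xs)

sum-map-zero : ∀ {A : Set} {f : A → ℕ} → (∀ x → f x ≡ 0) → ∀ xs → sum (map f xs) ≡ 0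
sum-map-zero f≡0 []       = refl
sum-map-zero f≡0 (x ∷ xs) = cong₂ _+_ (f≡0 x) (sum-map-zero f≡0 xs)

preimageSize-mono : ∀ {n} {φ ψ : Fin n → Fin n} {v w} → (∀ u → φ u ≡ v → ψ u ≡ w) →
                    preimageSize φ v ≤ preimageSize ψ w
preimageSize-mono {n} {φ} {ψ} {v} {w} hit = sum-map-mono indicator-mono (allFin n)
  where
  indicator-mono : ∀ u → (if ⌊ φ u ≟ v ⌋ then 1 else 0) ≤ (if ⌊ ψ u ≟ w ⌋ then 1 else 0)
  indicator-mono u with φ u ≟ v | ψ u ≟ w
  ... | no _     | _       = z≤n
  ... | yes _    | yes _   = ≤-refl
  ... | yes φu≡v | no ψu≢w = ⊥-elim (ψu≢w (hit u φu≡v))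

preimageSize-unhit : ∀ {n} {φ : Fin n → Fin n} {v} → (∀ u → φ u ≢ v) → preimageSize φ v ≡ 0
preimageSize-unhit {n} {φ} {v} miss = sum-map-zero indicator-zero (allFin n)
  where
  indicator-zero : ∀ u → (if ⌊ φ u ≟ v ⌋ then 1 else 0) ≡ 0
  indicator-zero u with φ u ≟ v
  ... | no _     = refl
  ... | yes φu≡v = ⊥-elim (miss u φu≡v)

module _ {n : ℕ} (G : Graph n) where

  data Reach : ℕ → Fin n → Fin n → Set where
    stay : ∀ {ℓ x} → Reach ℓ x x
    step : ∀ {ℓ x y z} → Reach ℓ x y → T (adj G y z) → Reach (suc ℓ) x z

  Reach-mono : ∀ {a b x y} → a ≤ b → Reach a x y → Reach b x y
  Reach-mono _       stay       = stay
  Reach-mono (s≤s p) (step r e) = step (Reach-mono p r) e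

  Reach-trans : ∀ {a b x y z} → Reach a x y → Reach b y z → Reach (b + a) x z
  Reach-trans r stay        = Reach-mono (m≤n+m _ _) r
  Reach-trans r (step r′ e) = step (Reach-trans r r′) e

  Reach-cons : ∀ {ℓ x y z} → T (adj G x y) → Reach ℓ y z → Reach (suc ℓ) x z
  Reach-cons e stay        = step stay e
  Reach-cons e (step r e′) = step (Reach-cons e r) e′

  Reach-sym : ∀ {ℓ x y} → Reach ℓ x y → Reach ℓ y x
  Reach-sym stay                   = stay
  Reach-sym (step {y = y} {z} r e) = Reach-cons (subst T (Graph.sym G y z) e) (Reach-sym r)

  ∈⇒T : ∀ {x} {p : Subset n} → x ∈ p → T (lookup p x)
  ∈⇒T x∈p = Equivalence.from T-≡ ([]=⇒lookup x∈p)

  T⇒∈ : ∀ {x} {p : Subset n} → T (lookup p x) → x ∈ p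
  T⇒∈ {x} {p} t = lookup⇒[]= x p (Equivalence.to T-≡ t)

  ∈N^suc⇔ : ∀ ℓ {U v} → v ∈ N^ G (suc ℓ) U ⇔ (v ∈ N^ G ℓ U ⊎ ∃ λ w → w ∈ N^ G ℓ U × T (adj G w v))
  ∈N^suc⇔ ℓ {U} {v} = mk⇔ to from
    where
    Nearby : Set
    Nearby = ∃ λ w → w ∈ N^ G ℓ U × T (adj G w v)

    to : v ∈ N^ G (suc ℓ) U → v ∈ N^ G ℓ U ⊎ Nearby
    to v∈ with Equivalence.to T-∨ (subst T (lookup∘tabulate _ v) (∈⇒T v∈))
    ... | inj₁ t = inj₁ (T⇒∈ t)
    ... | inj₂ t with satisfied (any⁻ _ (allFin n) t)
    ...   | w , tw with Equivalence.to T-∧ tw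
    ...     | w∈ , e = inj₂ (w , T⇒∈ w∈ , e)

    near : Nearby → T (any (λ w → lookup (N^ G ℓ U) w ∧ adj G w v) (allFin n))
    near (w , w∈ , e) = any⁺ _ (lose (∈-allFin w) (Equivalence.from T-∧ (∈⇒T w∈ , e)))

    from : v ∈ N^ G ℓ U ⊎ Nearby → v ∈ N^ G (suc ℓ) U
    from h = T⇒∈ (subst T (≡-sym (lookup∘tabulate _ v)) (Equivalence.from T-∨ (⊎-map ∈⇒T near h)))

  ∈N^⇒Reach : ∀ ℓ {U v} → v ∈ N^ G ℓ U → ∃ λ u → u ∈ U × Reach ℓ u v
  ∈N^⇒Reach zero    v∈ = _ , v∈ , stay
  ∈N^⇒Reach (suc ℓ) v∈ with Equivalence.to (∈N^suc⇔ ℓ) v∈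
  ... | inj₁ v∈′ with ∈N^⇒Reach ℓ v∈′
  ...   | u , u∈ , r = u , u∈ , Reach-mono (n≤1+n ℓ) r
  ∈N^⇒Reach (suc ℓ) v∈ | inj₂ (w , w∈ , e) with ∈N^⇒Reach ℓ w∈
  ...   | u , u∈ , r = u , u∈ , step r e

  Reach⇒∈N^ : ∀ ℓ {U u v} → u ∈ U → Reach ℓ u v → v ∈ N^ G ℓ U
  Reach⇒∈N^ zero    u∈ stay       = u∈
  Reach⇒∈N^ (suc ℓ) u∈ stay       = Equivalence.from (∈N^suc⇔ ℓ) (inj₁ (Reach⇒∈N^ ℓ u∈ stay))
  Reach⇒∈N^ (suc ℓ) u∈ (step r e) = Equivalence.from (∈N^suc⇔ ℓ) (inj₂ (_ , Reach⇒∈N^ ℓ u∈ r , e))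

  ⊆N^ : ∀ ℓ {U} → U ⊆ N^ G ℓ U
  ⊆N^ ℓ u∈ = Reach⇒∈N^ ℓ u∈ stay

  N^-mono : ∀ ℓ {U V} → U ⊆ V → N^ G ℓ U ⊆ N^ G ℓ V
  N^-mono ℓ U⊆V v∈ with ∈N^⇒Reach ℓ v∈
  ... | u , u∈ , r = Reach⇒∈N^ ℓ (U⊆V u∈) r

  Dist≤⇒Reach : ∀ {ℓ u v} → Dist≤ G ℓ u v → Reach ℓ u v
  Dist≤⇒Reach {ℓ} {u} d with ∈N^⇒Reach ℓ d
  ... | w , w∈ , r = subst (λ w → Reach ℓ w _) (x∈⁅y⁆⇒x≡y u w∈) r

  record Apart (d : ℕ) (B C : Subset n) : Set where
    constructor mkApart
    field
      far : ∀ {x} → x ∈ B → x ∉ N^ G d C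

  Apart-mono : ∀ {d B B′ C C′} → B′ ⊆ B → C′ ⊆ C → Apart d B C → Apart d B′ C′
  Apart-mono {d} B′⊆B C′⊆C (mkApart far) = mkApart λ x∈B′ x∈N → far (B′⊆B x∈B′) (N^-mono d C′⊆C x∈N)

  Apart⇒balls-disjoint : ∀ {d B C} → Apart d B C → ∀ a b {s} → a + b ≤ d →
                         s ∈ N^ G a B → s ∉ N^ G b C
  Apart⇒balls-disjoint {d} (mkApart far) a b a+b≤d s∈NB s∈NC with ∈N^⇒Reach a s∈NB | ∈N^⇒Reach b s∈NC
  ... | u , u∈B , r | c , c∈C , r′ =
    far u∈B (Reach⇒∈N^ d c∈C (Reach-mono a+b≤d (Reach-trans r′ (Reach-sym r))))

module _ {n : ℕ} (G : Graph n) (α : ℕ) where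

  data Clustered : Subset n → Set where
    ∅-clustered : Clustered ⊥
    ∪-clustered : ∀ {B C} → Clustered B → ∣ C ∣ ≤ α → Apart G 6 B C → Clustered (B ∪ C)

  Clustered-⊆ : ∀ {B B′} → Clustered B → B′ ⊆ B → Clustered B′
  Clustered-⊆ {B′ = B′} ∅-clustered B′⊆⊥ =
    subst Clustered (≡-sym (⊆-antisym B′⊆⊥ (⊆-min B′))) ∅-clustered
  Clustered-⊆ {B′ = B′} (∪-clustered {B} {C} clB ∣C∣≤α apart) B′⊆B∪C =
    subst Clustered split (∪-clustered (Clustered-⊆ clB (p∩q⊆q B′ B)) (≤-trans (∣p∩q∣≤∣q∣ B′ C) ∣C∣≤α)
                                         (Apart-mono G (p∩q⊆q B′ B) (p∩q⊆q B′ C) apart))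
    where
    split : (B′ ∩ B) ∪ (B′ ∩ C) ≡ B′
    split = trans (≡-sym (∩-distribˡ-∪ B′ B C)) (⊆-antisym (p∩q⊆p B′ _) λ x∈B′ → x∈p∩q⁺ (x∈B′ , B′⊆B∪C x∈B′))

  Clustered-step : ∀ {L B B′} → Clustered B → Step G L α B B′ → Clustered B′
  Clustered-step {B = B} clB (U , ∣U∣≤α , _ , refl) =
    ∪-clustered (Clustered-⊆ clB (p─q⊆p B (N^ G 6 U))) ∣U∣≤α (mkApart (x∈p─q⇒x∉q {p = B}))

  Clustered-star : ∀ {L B B′} → Clustered B → Star (Step G L α) B B′ → Clustered B′
  Clustered-star clB ε           = clB
  Clustered-star clB (s ◅ steps) = Clustered-star (Clustered-step clB s) steps

Recovers : ∀ {n} → Graph n → (Fin n → ℕ) → ℕ → Subset n → (Fin n → Fin n) → Set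
Recovers {n} G L α S φ₀ =
  ∀ (F : Subset n) → F ⊆ S → ∣ F ∣ ≤ α →
    Σ (Fin n → Fin n) λ φF →
      ValidAssignment G L S φF × (∀ u → φF u ∉ F) × (∀ u → φ₀ u ∉ F → φF u ≡ φ₀ u)

module Repairing {n : ℕ} (G : Graph n) (L : Fin n → ℕ) (α : ℕ) {S : Subset n} {φ₀ : Fin n → Fin n}
                 (valid₀ : ValidAssignment G L S φ₀) (recover : Recovers G L α S φ₀) where

  more-than-α-centres-near : ∀ c → α < ∣ S ∩ N^ G 1 ⁅ c ⁆ ∣
  more-than-α-centres-near c with ∣ S ∩ N^ G 1 ⁅ c ⁆ ∣ ≤? α
  ... | no  ≰α = ≰⇒> ≰α
  ... | yes ≤α with recover (S ∩ N^ G 1 ⁅ c ⁆) (p∩q⊆p S _) ≤α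
  ...   | φF , (into-S , near , _) , avoids , _ = ⊥-elim (avoids c (x∈p∩q⁺ (into-S c , near c)))

  ∣C∣≤∣S∩N¹C∣ : ∀ {C} → ∣ C ∣ ≤ α → ∣ C ∣ ≤ ∣ S ∩ N^ G 1 C ∣
  ∣C∣≤∣S∩N¹C∣ {C} ∣C∣≤α with nonempty? C
  ... | no  empty     = subst (_≤ ∣ S ∩ N^ G 1 C ∣) (≡-sym (trans (cong ∣_∣ (Empty-unique empty)) (∣⊥∣≡0 n))) z≤n
  ... | yes (c , c∈C) =
    <⇒≤ (≤-<-trans ∣C∣≤α (<-≤-trans (more-than-α-centres-near c) (p⊆q⇒∣p∣≤∣q∣ (∩-monoʳ S (N^-mono G 1 ⁅c⁆⊆C)))))
    where
    ⁅c⁆⊆C : ⁅ c ⁆ ⊆ C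
    ⁅c⁆⊆C x∈⁅c⁆ = subst (_∈ C) (≡-sym (x∈⁅y⁆⇒x≡y c x∈⁅c⁆)) c∈C

  failure-set : ∀ {C} → ∣ C ∣ ≤ α → ∃ λ F → S ∩ C ⊆ F × F ⊆ S ∩ N^ G 1 C × ∣ F ∣ ≡ ∣ C ∣
  failure-set {C} ∣C∣≤α =
    ⊆-interpolate (S ∩ C) (S ∩ N^ G 1 C) ∣ C ∣ (∩-monoʳ S (⊆N^ G 1 {C})) (∣p∩q∣≤∣q∣ S C) (∣C∣≤∣S∩N¹C∣ {C} ∣C∣≤α)

  record Repair (B : Subset n) : Set where
    field
      F         : Subset n
      S∩B⊆F     : S ∩ B ⊆ F
      F⊆S∩N¹B   : F ⊆ S ∩ N^ G 1 B
      ∣F∣≡∣B∣   : ∣ F ∣ ≡ ∣ B ∣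
      φ         : Fin n → Fin n
      valid     : ValidAssignment G L S φ
      φ-avoids  : ∀ u → φ u ∉ F
      φ-local   : ∀ u → φ u ≡ φ₀ u ⊎ φ u ∈ N^ G 3 B

  repair-∅ : Repair ⊥
  repair-∅ = record
    { F = ⊥ ; S∩B⊆F = p∩q⊆q S ⊥ ; F⊆S∩N¹B = λ x∈⊥ → ⊥-elim (∉⊥ x∈⊥) ; ∣F∣≡∣B∣ = refl
    ; φ = φ₀ ; valid = valid₀ ; φ-avoids = λ _ → ∉⊥ ; φ-local = λ _ → inj₁ refl }

  module AddCluster {B C} (I : Repair B) (apart : Apart G 6 B C)
                {FC} (S∩C⊆FC : S ∩ C ⊆ FC) (FC⊆S∩N¹C : FC ⊆ S ∩ N^ G 1 C) (∣FC∣≡∣C∣ : ∣ FC ∣ ≡ ∣ C ∣)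
                {φC} (validC : ValidAssignment G L S φC) (φC-avoids : ∀ u → φC u ∉ FC)
                (φC-agrees : ∀ u → φ₀ u ∉ FC → φC u ≡ φ₀ u) where
    open Repair I
    open ≡-Reasoning

    F-near-B : F ⊆ N^ G 1 B
    F-near-B x∈F = p∩q⊆q S _ (F⊆S∩N¹B x∈F)

    FC-near-C : FC ⊆ N^ G 1 C
    FC-near-C x∈FC = p∩q⊆q S _ (FC⊆S∩N¹C x∈FC)

    φC-near-C : ∀ u → φ₀ u ∈ FC → φC u ∈ N^ G 3 C
    φC-near-C u φ₀u∈FC with ∈N^⇒Reach G 1 {C} (FC-near-C φ₀u∈FC)
    ... | c , c∈C , c⇝φ₀u = Reach⇒∈N^ G 3 c∈C (Reach-trans G (Reach-trans G c⇝φ₀u φ₀u⇝u) u⇝φCu)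
      where
      φ₀u⇝u : Reach G 1 (φ₀ u) u
      φ₀u⇝u = Reach-sym G (Dist≤⇒Reach G {1} {u} (proj₁ (proj₂ valid₀) u))
      u⇝φCu : Reach G 1 u (φC u)
      u⇝φCu = Dist≤⇒Reach G {1} {u} (proj₁ (proj₂ validC) u)

    φ′ : Fin n → Fin n
    φ′ u with φ₀ u ∈? FC
    ... | yes _ = φC u
    ... | no  _ = φ u

    φ′-in-S : ∀ u → φ′ u ∈ S
    φ′-in-S u with φ₀ u ∈? FC
    ... | yes _ = proj₁ validC u
    ... | no  _ = proj₁ valid u

    φ′-near : ∀ u → Dist≤ G 1 u (φ′ u)
    φ′-near u with φ₀ u ∈? FC
    ... | yes _ = proj₁ (proj₂ validC) u
    ... | no  _ = proj₁ (proj₂ valid) u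

    φ′-avoids : ∀ u → φ′ u ∉ F ∪ FC
    φ′-avoids u φ′u∈F∪FC with φ₀ u ∈? FC | x∈p∪q⁻ F FC φ′u∈F∪FC
    ... | yes φ₀u∈FC | inj₁ φCu∈F  =
      Apart⇒balls-disjoint G apart 1 3 (s≤s (s≤s (s≤s (s≤s z≤n)))) (F-near-B φCu∈F) (φC-near-C u φ₀u∈FC)
    ... | yes _      | inj₂ φCu∈FC = φC-avoids u φCu∈FC
    ... | no  _      | inj₁ φu∈F   = φ-avoids u φu∈F
    ... | no  φ₀u∉FC | inj₂ φu∈FC with φ-local u
    ...   | inj₁ φu≡φ₀u = φ₀u∉FC (subst (_∈ FC) φu≡φ₀u φu∈FC)
    ...   | inj₂ φu∈N³B =
      Apart⇒balls-disjoint G apart 3 1 (s≤s (s≤s (s≤s (s≤s z≤n)))) φu∈N³B (FC-near-C φu∈FC)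

    φ′-local : ∀ u → φ′ u ≡ φ₀ u ⊎ φ′ u ∈ N^ G 3 (B ∪ C)
    φ′-local u with φ₀ u ∈? FC
    ... | yes φ₀u∈FC = inj₂ (N^-mono G 3 (q⊆p∪q B C) (φC-near-C u φ₀u∈FC))
    ... | no  _      = map₂ (N^-mono G 3 (p⊆p∪q {p = B} C)) (φ-local u)

    φ′-hits-near-C : ∀ {s} → s ∈ N^ G 3 C → ∀ u → φ′ u ≡ s → φC u ≡ s
    φ′-hits-near-C s∈N³C u φ′u≡s with φ₀ u ∈? FC
    ... | yes _ = φ′u≡s
    ... | no φ₀u∉FC with φ-local u
    ...   | inj₁ φu≡φ₀u = trans (φC-agrees u φ₀u∉FC) (trans (≡-sym φu≡φ₀u) φ′u≡s)
    ...   | inj₂ φu∈N³B =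
      ⊥-elim (Apart⇒balls-disjoint G apart 3 3 ≤-refl (subst (_∈ N^ G 3 B) φ′u≡s φu∈N³B) s∈N³C)

    φ′-hits-far-C : ∀ {s} → s ∉ N^ G 3 C → ∀ u → φ′ u ≡ s → φ u ≡ s
    φ′-hits-far-C s∉N³C u φ′u≡s with φ₀ u ∈? FC
    ... | yes φ₀u∈FC = ⊥-elim (s∉N³C (subst (_∈ N^ G 3 C) φ′u≡s (φC-near-C u φ₀u∈FC)))
    ... | no  _      = φ′u≡s

    φ′-capacity : ∀ s → preimageSize φ′ s ≤ L s
    φ′-capacity s with s ∈? N^ G 3 C
    ... | yes s∈N³C = ≤-trans (preimageSize-mono (φ′-hits-near-C s∈N³C)) (proj₂ (proj₂ validC) s)
    ... | no  s∉N³C = ≤-trans (preimageSize-mono (φ′-hits-far-C s∉N³C)) (proj₂ (proj₂ valid) s)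

    B∩C-disjoint : ∀ {x} → x ∈ B → x ∉ C
    B∩C-disjoint x∈B x∈C = Apart.far apart x∈B (⊆N^ G 6 x∈C)

    F∩FC-disjoint : ∀ {x} → x ∈ F → x ∉ FC
    F∩FC-disjoint x∈F x∈FC =
      Apart⇒balls-disjoint G apart 1 1 (s≤s (s≤s z≤n)) (F-near-B x∈F) (FC-near-C x∈FC)

    repaired : Repair (B ∪ C)
    repaired = record
      { F        = F ∪ FC
      ; S∩B⊆F    = ⊆-trans (⊆-reflexive (∩-distribˡ-∪ S B C)) (∪-mono S∩B⊆F S∩C⊆FC)
      ; F⊆S∩N¹B  = ∪-lub (⊆-trans F⊆S∩N¹B (∩-monoʳ S (N^-mono G 1 (p⊆p∪q {p = B} C))))
                         (⊆-trans FC⊆S∩N¹C (∩-monoʳ S (N^-mono G 1 (q⊆p∪q B C))))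
      ; ∣F∣≡∣B∣  = begin
          ∣ F ∪ FC ∣       ≡⟨ ∣p∪q∣≡∣p∣+∣q∣ F FC F∩FC-disjoint ⟩
          ∣ F ∣ + ∣ FC ∣   ≡⟨ cong₂ _+_ ∣F∣≡∣B∣ ∣FC∣≡∣C∣ ⟩
          ∣ B ∣ + ∣ C ∣    ≡⟨ ∣p∪q∣≡∣p∣+∣q∣ B C B∩C-disjoint ⟨
          ∣ B ∪ C ∣        ∎
      ; φ        = φ′
      ; valid    = φ′-in-S , φ′-near , φ′-capacity
      ; φ-avoids = φ′-avoids
      ; φ-local  = φ′-local
      }

  repair-∪ : ∀ {B C} → Repair B → ∣ C ∣ ≤ α → Apart G 6 B C → Repair (B ∪ C)
  repair-∪ {C = C} I ∣C∣≤α apart with failure-set ∣C∣≤α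
  ... | FC , S∩C⊆FC , FC⊆S∩N¹C , ∣FC∣≡∣C∣
    with recover FC (⊆-trans FC⊆S∩N¹C (p∩q⊆p S _)) (subst (_≤ α) (≡-sym ∣FC∣≡∣C∣) ∣C∣≤α)
  ...   | φC , validC , φC-avoids , φC-agrees =
    AddCluster.repaired I apart S∩C⊆FC FC⊆S∩N¹C ∣FC∣≡∣C∣ validC φC-avoids φC-agrees

  repair : ∀ {B} → Clustered G α B → Repair B
  repair ∅-clustered                   = repair-∅
  repair (∪-clustered clB ∣C∣≤α apart) = repair-∪ (repair clB) ∣C∣≤α apart

  avoids-B : ∀ {B} (I : Repair B) u → Repair.φ I u ∉ B
  avoids-B I u φu∈B = φ-avoids u (S∩B⊆F (x∈p∩q⁺ (proj₁ valid u , φu∈B)))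
    where open Repair I

lemma3 : {n : ℕ} (G : Graph n) → Connected G →
         (k α : ℕ) → α < k → (L : Fin n → ℕ) →
         (B : Subset n) → ProcedureOutput G (cap L) α B →
         FTFeasible G k (cap L) α →
         CkCFeasible G (k ∸ ∣ B ∣) (zeroOn B (cap L))
lemma3 G _ k α _ L B (steps , _) (S , ∣S∣≡k , φ₀ , valid₀ , recover) =
  S ─ F , ∣S─F∣≡k∸∣B∣ , φ , (λ u → x∈p∧x∉q⇒x∈p─q (proj₁ valid u) (φ-avoids u)) , proj₁ (proj₂ valid) , capacity
  where
  open Repairing G (cap L) α valid₀ recover
  I : Repair B
  I = repair (Clustered-star G α ∅-clustered steps)
  open Repair I
  open ≡-Reasoning

  ∣S─F∣≡k∸∣B∣ : ∣ S ─ F ∣ ≡ k ∸ ∣ B ∣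
  ∣S─F∣≡k∸∣B∣ = begin
    ∣ S ─ F ∣                   ≡⟨ m+n∸n≡m ∣ S ─ F ∣ ∣ F ∣ ⟨
    ∣ S ─ F ∣ + ∣ F ∣ ∸ ∣ F ∣   ≡⟨ cong₂ _∸_ (trans (∣p─q∣+∣q∣≡∣p∣ S F (⊆-trans F⊆S∩N¹B (p∩q⊆p S _))) ∣S∣≡k) ∣F∣≡∣B∣ ⟩
    k ∸ ∣ B ∣                   ∎

  capacity : ∀ v → preimageSize φ v ≤ zeroOn B (cap L) v
  capacity v with lookup B v in B[v]≡true
  ... | false = proj₂ (proj₂ valid) v
  ... | true  = ≤-reflexive (preimageSize-unhit λ u φu≡v →
                  avoids-B I u (subst (_∈ B) (≡-sym φu≡v) (lookup⇒[]= v B B[v]≡true)))
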